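{- Let $p$ be a prime, $T$ a finite tree and $\ell: V(T)\to\mathbb{Z}_p$. If $(T,\ell)$ is zero-avoiding, then $|Q(t,T)|\geq|V(T)|$ for every vertex $t\in V(T)$.
   Context: For a map $\ell:V(G)\to\mathbb{Z}_p$ on a graph $G$, write $\ell(A)=\sum_{x\in A}\ell(x)$ for $A\subseteq V(G)$; $A$ is connected if $G[A]$ is connected. $(G,\ell)$ is zero-avoiding if $\ell(A)\neq0$ for every non-empty connected $A\subseteq V(G)$. For $v\in V(G)$, $Q(v,G):=\{\ell(A): v\in A\subseteq V(G),\ A \text{ connected}\}$. -}

module Defs where

open import Data.Nat using (ℕ; zero; suc; _+_; _≤_; _%_; NonZero)
open import Data.Fin using (Fin; toℕ)
import Data.Fin as F
open import Data.Fin.Subset using (Subset; _∈_; Nonempty; ⊤)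
open import Data.Vec using (lookup)
open import Data.Bool using (if_then_else_)
open import Data.List using (List; _∷_; []; _++_; [_]; length)
open import Data.List.Relation.Unary.Unique.Propositional using (Unique)
open import Data.List.Relation.Unary.Linked using (Linked)
open import Data.Product using (Σ; _×_; ∃)
open import Relation.Nullary using (¬_)
open import Relation.Binary.PropositionalEquality using (_≡_; _≢_)

record Graph (n : ℕ) : Set₁ where
  field
    E     : Fin n → Fin n → Set
    sym   : ∀ {x y} → E x y → E y x
    irref : ∀ {x} → ¬ E x x
open Graph public

data WalkIn {n : ℕ} (G : Graph n) (A : Subset n) : Fin n → Fin n → Set where
  here : ∀ {x} → x ∈ A → WalkIn G A x x
  step : ∀ {x y z} → x ∈ A → E G x y → WalkIn G A y z → WalkIn G A x z

ConnectedSet : ∀ {n} → Graph n → Subset n → Set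
ConnectedSet G A = ∀ x y → x ∈ A → y ∈ A → WalkIn G A x y

HasCycle : ∀ {n} → Graph n → Set
HasCycle {n} G = Σ (Fin n) λ x → Σ (List (Fin n)) λ ys →
  (2 ≤ length ys) × Unique (x ∷ ys) × Linked (E G) (x ∷ ys ++ [ x ])

IsTree : ∀ {n} → Graph n → Set
IsTree {n} G = (1 ≤ n) × ConnectedSet G ⊤ × ¬ HasCycle G

sumFin : ∀ {n} → (Fin n → ℕ) → ℕ
sumFin {zero}  f = 0
sumFin {suc n} f = f F.zero + sumFin (λ i → f (F.suc i))

-- ℓ(A) ∈ ℤ_p, represented as the residue in {0,…,p-1}; ℤ_p is modelled as Fin p.
weight : ∀ {n} p .{{_ : NonZero p}} → (Fin n → Fin p) → Subset n → ℕ
weight p ℓ A = sumFin (λ x → if lookup A x then toℕ (ℓ x) else 0) % p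

ZeroAvoiding : ∀ {n} p .{{_ : NonZero p}} → Graph n → (Fin n → Fin p) → Set
ZeroAvoiding p G ℓ = ∀ A → Nonempty A → ConnectedSet G A → weight p ℓ A ≢ 0

InQ : ∀ {n} p .{{_ : NonZero p}} → Graph n → (Fin n → Fin p) → Fin n → Fin p → Set
InQ p G ℓ v r = Σ _ λ A → v ∈ A × ConnectedSet G A × weight p ℓ A ≡ toℕ r

module Submission where

-- Root the tree at t and cut the edge from t to a child c into the part T₁ containing t and
-- the subtree T₂ below c. A connected set of T₁ through t, joined across the edge with a
-- connected set of T₂ through c or not, is connected in T, so Q(t,T) ⊇ Q(t,T₁) + (Q(c,T₂) ∪ {0}).
-- Zero-avoidance keeps 0 out of Q(c,T₂), so adjoining 0 adds an element, and out of Q(t,T),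
-- so the sumset misses 0 and Cauchy–Davenport gives |Q(t,T)| ≥ |Q(t,T₁)| + |Q(c,T₂)|.
-- Induction over the decomposition yields |Q(t,T)| ≥ |V(T)|.

open import Algebra.Bundles using (AbelianGroup)
open import Algebra.Consequences.Propositional using (comm∧idˡ⇒id; comm∧invʳ⇒inv)
import Algebra.Properties.AbelianGroup as AbelianGroupProperties
import Algebra.Properties.CommutativeSemigroup as CommutativeSemigroupProperties
open import Data.Bool.Base using (Bool; true; false; if_then_else_; _∨_)
open import Data.Fin.Base using (Fin; zero; suc; toℕ; inject≤)
open import Data.Fin.Properties
  using (toℕ-injective; toℕ<n; toℕ-fromℕ<; suc-injective; inject≤-injective; any?; _≟_)
open import Data.Fin.Permutation using (Permutation′; permutation; _⟨$⟩ʳ_)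
open import Data.Fin.Subset
  using (Subset; _∈_; _∉_; _⊆_; _⊂_; _⊃_; _∪_; _∩_; ∁; ⊤; ⊥; ⁅_⁆; ∣_∣; Empty)
open import Data.Fin.Subset.Properties
  using ( _∈?_; nonempty?; ∈⊤; ⊆⊤; ⊆-antisym; p⊆q⇒∣p∣≤∣q∣; ∣⊥∣≡0; ∣⊤∣≡n; Empty-unique
        ; x∈⁅x⁆; x∈⁅y⁆⇒x≡y; ∣⁅x⁆∣≡1; x∈∁p⇒x∉p; x∉∁p⇒x∈p
        ; p⊆p∪q; q⊆p∪q; x∈p∪q⁻; ∪-assoc; ∪-comm; p∩q⊆p; x∈p∩q⁺; x∈p∩q⁻ )
open import Data.Fin.Subset.Induction using (⊂-wellFounded; ⊃-wellFounded; Acc; acc)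
open import Data.Nat.Base
  using (ℕ; zero; suc; _+_; _*_; _∸_; _≤_; _<_; s≤s; _%_; NonZero; ≢-nonZero; nonTrivial⇒n>1)
open import Data.Nat.Coprimality using (coprime-Bézout; prime⇒coprime)
open import Data.Nat.DivMod
  using ( _mod_; m%n<n; m<n⇒m%n≡m; m%n%n≡m%n; n%n≡0; m*n%n≡0; [m+kn]%n≡m%n
        ; %-distribˡ-+; %-distribˡ-* )
open import Data.Nat.GCD using (module Bézout)
open import Data.Nat.Primality using (Prime; prime⇒nonZero; prime⇒nonTrivial)
open import Data.Nat.Properties
  using ( +-comm; +-assoc; +-suc; +-identityʳ; *-assoc; *-identityʳ; m+[n∸m]≡n
        ; <⇒≤; ≤-reflexive; ≤-trans; ≤-pred; +-mono-≤; +-monoʳ-≤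
        ; +-0-commutativeMonoid; module ≤-Reasoning )
open import Algebra.Properties.CommutativeMonoid.Sum +-0-commutativeMonoid
  using (sum; sum-permute; sum-cong-≗; ∑-distrib-+; sum-replicate-zero)
open import Data.Nat.Tactic.RingSolver using (solve-∀)
open import Data.Product.Base using (Σ; ∃; ∃₂; _×_; _,_; proj₁; proj₂; uncurry)
open import Data.Sum.Base using (inj₁; inj₂; [_,_]′)
open import Data.Vec.Base using ([]; _∷_; lookup; tabulate; replicate; here; there)
open import Data.Vec.Properties
  using (lookup∘tabulate; lookup⇒[]=; []=⇒lookup; lookup-zipWith; lookup-replicate)
open import Function.Base using (id; _∘_)
open import Function.Definitions using (Injective)
open import Level using (0ℓ)
open import Relation.Binary.PropositionalEquality
open import Relation.Nullary.Decidable
  using (Dec; yes; no; does; dec-true; decidable-stable; _×-dec_; ¬?)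
open import Relation.Nullary.Negation using (contradiction)
open import Relation.Unary using (Pred; Decidable)

open import Defs hiding (sym)

[1+kp]%p≡1 : ∀ {p} .{{_ : NonZero p}} → Prime p → ∀ k → (1 + k * p) % p ≡ 1
[1+kp]%p≡1 {p} pr k = trans ([m+kn]%n≡m%n 1 k p) (m<n⇒m%n≡m (nonTrivial⇒n>1 p {{prime⇒nonTrivial pr}}))

mod-inverse : ∀ {p d} .{{_ : NonZero p}} → Prime p → .{{_ : NonZero d}} → d < p →
              ∃ λ u → (u * d) % p ≡ 1
mod-inverse {suc m} {d} pr d<p with coprime-Bézout (prime⇒coprime pr d<p)
... | Bézout.-+ x y 1+xp≡yd = y , trans (cong (_% suc m) (sym 1+xp≡yd)) ([1+kp]%p≡1 pr x)
-- Here y d ≡ -1, so (p - 1) y inverts d.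
... | Bézout.+- x y 1+yd≡xp = m * y , (begin
  (m * y * d) % p            ≡⟨ [m+kn]%n≡m%n (m * y * d) 1 p ⟨
  (m * y * d + 1 * p) % p    ≡⟨ cong (_% p) (rearrange m y d) ⟩
  (1 + m * (1 + y * d)) % p  ≡⟨ cong (λ t → (1 + m * t) % p) 1+yd≡xp ⟩
  (1 + m * (x * p)) % p      ≡⟨ cong (λ t → (1 + t) % p) (*-assoc m x p) ⟨
  (1 + m * x * p) % p        ≡⟨ [1+kp]%p≡1 pr (m * x) ⟩
  1                          ∎)
  where
  p : ℕ
  p = suc m
  rearrange : ∀ m y d → m * y * d + 1 * suc m ≡ 1 + m * (1 + y * d)
  rearrange = solve-∀
  open ≡-Reasoning

-- The additive group ℤ/pℤ on Fin p

module ZMod (p : ℕ) .{{_ : NonZero p}} where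

  infixl 6 _⊕_ _⊖_
  infixl 7 _·_

  _⊕_ : Fin p → Fin p → Fin p
  a ⊕ b = (toℕ a + toℕ b) mod p

  negate : Fin p → Fin p
  negate a = (p ∸ toℕ a) mod p

  _⊖_ : Fin p → Fin p → Fin p
  a ⊖ b = a ⊕ negate b

  0ₚ : Fin p
  0ₚ = 0 mod p

  _·_ : ℕ → Fin p → Fin p
  k · a = (k * toℕ a) mod p

  toℕ-mod : ∀ m → toℕ (m mod p) ≡ m % p
  toℕ-mod m = toℕ-fromℕ< (m%n<n m p)

  mod-cong : ∀ {m n} → m % p ≡ n % p → m mod p ≡ n mod p
  mod-cong eq = toℕ-injective (trans (toℕ-mod _) (trans eq (sym (toℕ-mod _))))

  mod-toℕ : ∀ a → toℕ a mod p ≡ a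
  mod-toℕ a = toℕ-injective (trans (toℕ-mod (toℕ a)) (m<n⇒m%n≡m (toℕ<n a)))

  toℕ-0ₚ : toℕ 0ₚ ≡ 0
  toℕ-0ₚ = trans (toℕ-mod 0) (m*n%n≡0 0 p)

  mod-distrib-+ : ∀ m n → (m + n) mod p ≡ m mod p ⊕ n mod p
  mod-distrib-+ m n = mod-cong (begin
    (m + n) % p                            ≡⟨ %-distribˡ-+ m n p ⟩
    (m % p + n % p) % p                    ≡⟨ cong₂ (λ x y → (x + y) % p) (toℕ-mod m) (toℕ-mod n) ⟨
    (toℕ (m mod p) + toℕ (n mod p)) % p    ∎)
    where open ≡-Reasoning

  ⊕-comm : ∀ a b → a ⊕ b ≡ b ⊕ a
  ⊕-comm a b = cong (_mod p) (+-comm (toℕ a) (toℕ b))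

  ⊕-assoc : ∀ a b c → (a ⊕ b) ⊕ c ≡ a ⊕ (b ⊕ c)
  ⊕-assoc a b c = begin
    (a ⊕ b) ⊕ c                          ≡⟨ cong ((a ⊕ b) ⊕_) (mod-toℕ c) ⟨
    (A + B) mod p ⊕ C mod p              ≡⟨ mod-distrib-+ (A + B) C ⟨
    (A + B + C) mod p                    ≡⟨ cong (_mod p) (+-assoc A B C) ⟩
    (A + (B + C)) mod p                  ≡⟨ mod-distrib-+ A (B + C) ⟩
    A mod p ⊕ (b ⊕ c)                    ≡⟨ cong (_⊕ (b ⊕ c)) (mod-toℕ a) ⟩
    a ⊕ (b ⊕ c)                          ∎
    where
    A B C : ℕ
    A = toℕ a
    B = toℕ b
    C = toℕ c
    open ≡-Reasoning

  ⊕-identityˡ : ∀ a → 0ₚ ⊕ a ≡ a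
  ⊕-identityˡ a = trans (cong (λ z → (z + toℕ a) mod p) toℕ-0ₚ) (mod-toℕ a)

  ⊕-inverseʳ : ∀ a → a ⊕ negate a ≡ 0ₚ
  ⊕-inverseʳ a = begin
    a ⊕ negate a                 ≡⟨ cong (_⊕ negate a) (mod-toℕ a) ⟨
    toℕ a mod p ⊕ negate a       ≡⟨ mod-distrib-+ (toℕ a) (p ∸ toℕ a) ⟨
    (toℕ a + (p ∸ toℕ a)) mod p  ≡⟨ cong (_mod p) (m+[n∸m]≡n (<⇒≤ (toℕ<n a))) ⟩
    p mod p                      ≡⟨ mod-cong (trans (n%n≡0 p) (sym (m*n%n≡0 0 p))) ⟩
    0ₚ                           ∎
    where open ≡-Reasoning

  ⊕-abelianGroup : AbelianGroup 0ℓ 0ℓ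
  ⊕-abelianGroup = record
    { Carrier = Fin p
    ; _≈_ = _≡_
    ; _∙_ = _⊕_
    ; ε = 0ₚ
    ; _⁻¹ = negate
    ; isAbelianGroup = record
      { isGroup = record
        { isMonoid = record
          { isSemigroup = record
            { isMagma = record { isEquivalence = isEquivalence ; ∙-cong = cong₂ _⊕_ }
            ; assoc = ⊕-assoc }
          ; identity = comm∧idˡ⇒id ⊕-comm ⊕-identityˡ }
        ; inverse = comm∧invʳ⇒inv ⊕-comm ⊕-inverseʳ
        ; ⁻¹-cong = cong negate }
      ; comm = ⊕-comm } }

  open AbelianGroupProperties ⊕-abelianGroup
    using (//-rightDividesˡ; //-rightDividesʳ; x∙y⁻¹≈ε⇒x≈y)
  open CommutativeSemigroupProperties (AbelianGroup.commutativeSemigroup ⊕-abelianGroup)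
    using (x∙yz≈y∙xz; xy∙z≈x∙zy; interchange)

  ⊕-identityʳ : ∀ a → a ⊕ 0ₚ ≡ a
  ⊕-identityʳ = AbelianGroup.identityʳ ⊕-abelianGroup

  ⊖-⊕-cancel : ∀ x e → (x ⊖ e) ⊕ e ≡ x
  ⊖-⊕-cancel x e = //-rightDividesˡ e x

  ⊕-⊖-cancel : ∀ x e → (x ⊕ e) ⊖ e ≡ x
  ⊕-⊖-cancel x e = //-rightDividesʳ e x

  ⊕-⊖-cancelˡ : ∀ a x → a ⊕ (x ⊖ a) ≡ x
  ⊕-⊖-cancelˡ a x = trans (⊕-comm a (x ⊖ a)) (⊖-⊕-cancel x a)

  ⊖≡0ₚ⇒≡ : ∀ {x y} → x ⊖ y ≡ 0ₚ → x ≡ y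
  ⊖≡0ₚ⇒≡ = x∙y⁻¹≈ε⇒x≈y _ _

  ⊕-⊖-swap : ∀ x y z → x ⊕ (y ⊖ z) ≡ y ⊕ (x ⊖ z)
  ⊕-⊖-swap x y z = x∙yz≈y∙xz x y (negate z)

  ⊕-⊖-interchange : ∀ x y e → (y ⊕ e) ⊕ (x ⊖ e) ≡ x ⊕ y
  ⊕-⊖-interchange x y e = begin
    (y ⊕ e) ⊕ (x ⊖ e)         ≡⟨ interchange y e x (negate e) ⟩
    (y ⊕ x) ⊕ (e ⊖ e)         ≡⟨ cong ((y ⊕ x) ⊕_) (⊕-inverseʳ e) ⟩
    (y ⊕ x) ⊕ 0ₚ              ≡⟨ ⊕-identityʳ (y ⊕ x) ⟩
    y ⊕ x                     ≡⟨ ⊕-comm y x ⟩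
    x ⊕ y                     ∎
    where open ≡-Reasoning

  ·-suc : ∀ k a → suc k · a ≡ a ⊕ k · a
  ·-suc k a = trans (mod-distrib-+ (toℕ a) (k * toℕ a)) (cong (_⊕ k · a) (mod-toℕ a))

  toℕ≢0 : ∀ {d} → d ≢ 0ₚ → toℕ d ≢ 0
  toℕ≢0 d≢0 toℕd≡0 = d≢0 (toℕ-injective (trans toℕd≡0 (sym toℕ-0ₚ)))

  ·-surjective : Prime p → ∀ {d} → d ≢ 0ₚ → ∀ c → ∃ λ k → k · d ≡ c
  ·-surjective pr {d} d≢0 c
    with u , u*d%p≡1 ← mod-inverse pr {{≢-nonZero (toℕ≢0 d≢0)}} (toℕ<n d)
    = toℕ c * u , toℕ-injective (begin
    toℕ ((toℕ c * u) · d)                ≡⟨ toℕ-mod (toℕ c * u * toℕ d) ⟩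
    toℕ c * u * toℕ d % p                ≡⟨ cong (_% p) (*-assoc (toℕ c) u (toℕ d)) ⟩
    toℕ c * (u * toℕ d) % p              ≡⟨ %-distribˡ-* (toℕ c) (u * toℕ d) p ⟩
    (toℕ c % p * (u * toℕ d % p)) % p    ≡⟨ cong (λ t → (toℕ c % p * t) % p) u*d%p≡1 ⟩
    (toℕ c % p * 1) % p                  ≡⟨ cong (_% p) (*-identityʳ (toℕ c % p)) ⟩
    toℕ c % p % p                        ≡⟨ m%n%n≡m%n (toℕ c) p ⟩
    toℕ c % p                            ≡⟨ m<n⇒m%n≡m (toℕ<n c) ⟩
    toℕ c                                ∎)
    where open ≡-Reasoning

  ⊕-closed⇒universal : Prime p → ∀ {ℓ} (P : Pred (Fin p) ℓ) {d} → d ≢ 0ₚ →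
                       (∀ {x} → P x → P (x ⊕ d)) → ∀ {a} → P a → ∀ w → P w
  ⊕-closed⇒universal pr P {d} d≢0 closed {a} Pa w
    with k , k·d≡w⊖a ← ·-surjective pr d≢0 (w ⊖ a)
    = subst P (trans (cong (a ⊕_) k·d≡w⊖a) (⊕-⊖-cancelˡ a w)) (P[a⊕k·d] k)
    where
    P[a⊕k·d] : ∀ k → P (a ⊕ k · d)
    P[a⊕k·d] zero    = subst P (sym (⊕-identityʳ a)) Pa
    P[a⊕k·d] (suc k) = subst P (trans (xy∙z≈x∙zy a (k · d) d) (cong (a ⊕_) (sym (·-suc k d))))
                               (closed (P[a⊕k·d] k))

-- Subsets of Fin n

∣p∣≡∑ : ∀ {n} (X : Subset n) → ∣ X ∣ ≡ sum (λ i → if lookup X i then 1 else 0)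
∣p∣≡∑ []          = refl
∣p∣≡∑ (true ∷ X)  = cong suc (∣p∣≡∑ X)
∣p∣≡∑ (false ∷ X) = ∣p∣≡∑ X

module _ {n : ℕ} where

  ∈-tabulate⁺ : ∀ {f : Fin n → Bool} {x} → f x ≡ true → x ∈ tabulate f
  ∈-tabulate⁺ {f} {x} fx≡true = lookup⇒[]= x _ (trans (lookup∘tabulate f x) fx≡true)

  ∈-tabulate⁻ : ∀ {f : Fin n → Bool} {x} → x ∈ tabulate f → f x ≡ true
  ∈-tabulate⁻ {f} {x} x∈ = trans (sym (lookup∘tabulate f x)) ([]=⇒lookup x∈)

  select : ∀ {ℓ} {P : Pred (Fin n) ℓ} → Decidable P → Subset n
  select P? = tabulate (does ∘ P?)

  ∈-select⁺ : ∀ {ℓ} {P : Pred (Fin n) ℓ} (P? : Decidable P) {x} → P x → x ∈ select P?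
  ∈-select⁺ P? {x} px = ∈-tabulate⁺ (dec-true (P? x) px)

  ∈-select⁻ : ∀ {ℓ} {P : Pred (Fin n) ℓ} (P? : Decidable P) {x} → x ∈ select P? → P x
  ∈-select⁻ P? {x} x∈ with P? x | ∈-tabulate⁻ {f = does ∘ P?} x∈
  ... | yes px | _  = px
  ... | no _   | ()

  preimage : (Fin n → Fin n) → Subset n → Subset n
  preimage f X = tabulate (lookup X ∘ f)

  ∈-preimage⁺ : ∀ f {X x} → f x ∈ X → x ∈ preimage f X
  ∈-preimage⁺ f fx∈X = ∈-tabulate⁺ ([]=⇒lookup fx∈X)

  ∈-preimage⁻ : ∀ f {X x} → x ∈ preimage f X → f x ∈ X
  ∈-preimage⁻ f {X} x∈ = lookup⇒[]= (f _) X (∈-tabulate⁻ x∈)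

  ∣preimage∣ : ∀ (π : Permutation′ n) X → ∣ preimage (π ⟨$⟩ʳ_) X ∣ ≡ ∣ X ∣
  ∣preimage∣ π X = begin
    ∣ preimage (π ⟨$⟩ʳ_) X ∣                     ≡⟨ ∣p∣≡∑ (preimage (π ⟨$⟩ʳ_) X) ⟩
    sum (indicator ∘ lookup (preimage (π ⟨$⟩ʳ_) X)) ≡⟨ sum-cong-≗ (cong indicator ∘ lookup∘tabulate (lookup X ∘ (π ⟨$⟩ʳ_))) ⟩
    sum (indicator ∘ lookup X ∘ (π ⟨$⟩ʳ_))        ≡⟨ sum-permute (indicator ∘ lookup X) π ⟨
    sum (indicator ∘ lookup X)                    ≡⟨ ∣p∣≡∑ X ⟨
    ∣ X ∣                                         ∎
    where
    indicator : Bool → ℕ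
    indicator b = if b then 1 else 0
    open ≡-Reasoning

∣p∪q∣+∣p∩q∣≡∣p∣+∣q∣ : ∀ {n} (X Y : Subset n) → ∣ X ∪ Y ∣ + ∣ X ∩ Y ∣ ≡ ∣ X ∣ + ∣ Y ∣
∣p∪q∣+∣p∩q∣≡∣p∣+∣q∣ [] [] = refl
∣p∪q∣+∣p∩q∣≡∣p∣+∣q∣ (true ∷ X) (true ∷ Y) =
  cong suc (trans (+-suc _ _) (trans (cong suc (∣p∪q∣+∣p∩q∣≡∣p∣+∣q∣ X Y)) (sym (+-suc _ _))))
∣p∪q∣+∣p∩q∣≡∣p∣+∣q∣ (true ∷ X) (false ∷ Y) = cong suc (∣p∪q∣+∣p∩q∣≡∣p∣+∣q∣ X Y)
∣p∪q∣+∣p∩q∣≡∣p∣+∣q∣ (false ∷ X) (true ∷ Y) =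
  trans (cong suc (∣p∪q∣+∣p∩q∣≡∣p∣+∣q∣ X Y)) (sym (+-suc _ _))
∣p∪q∣+∣p∩q∣≡∣p∣+∣q∣ (false ∷ X) (false ∷ Y) = ∣p∪q∣+∣p∩q∣≡∣p∣+∣q∣ X Y

Disjoint : ∀ {n} → Subset n → Subset n → Set
Disjoint X Y = ∀ {x} → x ∈ X → x ∉ Y

Disjoint-sym : ∀ {n} {X Y : Subset n} → Disjoint X Y → Disjoint Y X
Disjoint-sym X#Y y∈Y y∈X = X#Y y∈X y∈Y

Disjoint-∪ˡ : ∀ {n} {X Y Z : Subset n} → Disjoint X Z → Disjoint Y Z → Disjoint (X ∪ Y) Z
Disjoint-∪ˡ {X = X} {Y} X#Z Y#Z x∈X∪Y = [ X#Z , Y#Z ]′ (x∈p∪q⁻ X Y x∈X∪Y)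

Disjoint-∪ʳ : ∀ {n} {X Y Z : Subset n} → Disjoint X Y → Disjoint X Z → Disjoint X (Y ∪ Z)
Disjoint-∪ʳ X#Y X#Z = Disjoint-sym (Disjoint-∪ˡ (Disjoint-sym X#Y) (Disjoint-sym X#Z))

∉⇒Disjoint⁅⁆ : ∀ {n} {X : Subset n} {y} → y ∉ X → Disjoint X ⁅ y ⁆
∉⇒Disjoint⁅⁆ {y = y} y∉X x∈X x∈⁅y⁆ = y∉X (subst (_∈ _) (x∈⁅y⁆⇒x≡y y x∈⁅y⁆) x∈X)

∣p∪q∣≡∣p∣+∣q∣ : ∀ {n} {X Y : Subset n} → Disjoint X Y → ∣ X ∪ Y ∣ ≡ ∣ X ∣ + ∣ Y ∣
∣p∪q∣≡∣p∣+∣q∣ {n} {X} {Y} X#Y = begin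
  ∣ X ∪ Y ∣              ≡⟨ +-identityʳ _ ⟨
  ∣ X ∪ Y ∣ + 0          ≡⟨ cong (∣ X ∪ Y ∣ +_) (∣⊥∣≡0 n) ⟨
  ∣ X ∪ Y ∣ + ∣ ⊥ {n} ∣  ≡⟨ cong (λ Z → ∣ X ∪ Y ∣ + ∣ Z ∣) X∩Y≡⊥ ⟨
  ∣ X ∪ Y ∣ + ∣ X ∩ Y ∣  ≡⟨ ∣p∪q∣+∣p∩q∣≡∣p∣+∣q∣ X Y ⟩
  ∣ X ∣ + ∣ Y ∣          ∎
  where
  X∩Y≡⊥ : X ∩ Y ≡ ⊥
  X∩Y≡⊥ = Empty-unique λ (x , x∈X∩Y) → uncurry X#Y (x∈p∩q⁻ X Y x∈X∩Y)
  open ≡-Reasoning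

Empty∁⇒≡⊤ : ∀ {n} {X : Subset n} → Empty (∁ X) → X ≡ ⊤
Empty∁⇒≡⊤ ∁X-empty = ⊆-antisym ⊆⊤ λ {x} _ → x∉∁p⇒x∈p λ x∈∁X → ∁X-empty (x , x∈∁X)

enumerate : ∀ {n} (X : Subset n) → Σ (Fin ∣ X ∣ → Fin n) λ f → Injective _≡_ _≡_ f × (∀ i → f i ∈ X)
enumerate [] = (λ ()) , (λ { {()} }) , λ ()
enumerate (false ∷ X) with f , f-injective , f∈X ← enumerate X =
  suc ∘ f , f-injective ∘ suc-injective , there ∘ f∈X
enumerate (true ∷ X) with f , f-injective , f∈X ← enumerate X = g , g-injective , g∈
  where
  g : Fin (suc ∣ X ∣) → Fin _
  g zero    = zero
  g (suc i) = suc (f i)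
  g-injective : Injective _≡_ _≡_ g
  g-injective {zero}  {zero}  _  = refl
  g-injective {suc i} {suc j} eq = cong suc (f-injective (suc-injective eq))
  g∈ : ∀ i → g i ∈ (true ∷ X)
  g∈ zero    = here
  g∈ (suc i) = there (f∈X i)

injection-into : ∀ {m n} (X : Subset n) → m ≤ ∣ X ∣ →
                 Σ (Fin m → Fin n) λ f → Injective _≡_ _≡_ f × (∀ i → f i ∈ X)
injection-into X m≤∣X∣ with f , f-injective , f∈X ← enumerate X =
  (λ i → f (inject≤ i m≤∣X∣)) ,
  (λ eq → inject≤-injective m≤∣X∣ m≤∣X∣ _ _ (f-injective eq)) ,
  (λ i → f∈X (inject≤ i m≤∣X∣))

sumOver : ∀ {n} → Subset n → (Fin n → ℕ) → ℕ
sumOver X g = sum λ x → if lookup X x then g x else 0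

sumFin≡sum : ∀ {n} (f : Fin n → ℕ) → sumFin f ≡ sum f
sumFin≡sum {zero}  f = refl
sumFin≡sum {suc n} f = cong (f zero +_) (sumFin≡sum (f ∘ suc))

sumOver-∪ : ∀ {n} {X Y : Subset n} g → Disjoint X Y → sumOver (X ∪ Y) g ≡ sumOver X g + sumOver Y g
sumOver-∪ {X = X} {Y} g X#Y = trans (sum-cong-≗ split) (∑-distrib-+ (indicatorₗ X) (indicatorₗ Y))
  where
  indicatorₗ : Subset _ → Fin _ → ℕ
  indicatorₗ Z x = if lookup Z x then g x else 0
  split : ∀ x → indicatorₗ (X ∪ Y) x ≡ indicatorₗ X x + indicatorₗ Y x
  split x rewrite lookup-zipWith _∨_ x X Y with lookup X x in x∈X | lookup Y x in x∈Y
  ... | true  | true  = contradiction (lookup⇒[]= x Y x∈Y) (X#Y (lookup⇒[]= x X x∈X))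
  ... | true  | false = sym (+-identityʳ (g x))
  ... | false | _     = refl

sumOver-⁅⁆ : ∀ {n} (r : Fin n) g → sumOver ⁅ r ⁆ g ≡ g r
sumOver-⁅⁆ {suc n} zero    g = trans (cong (g zero +_) (trans (sum-cong-≗ outside) (sum-replicate-zero n)))
                                     (+-identityʳ (g zero))
  where
  outside : ∀ i → (if lookup (replicate n false) i then g (suc i) else 0) ≡ 0
  outside i = cong (if_then g (suc i) else 0) (lookup-replicate i false)
sumOver-⁅⁆ {suc n} (suc r) g = sumOver-⁅⁆ r (g ∘ suc)

-- The Cauchy–Davenport theorem

module CauchyDavenport {p : ℕ} (prime : Prime p) where

  private instance
    p≢0 : NonZero p
    p≢0 = prime⇒nonZero prime

  open ZMod p

  private variable
    A B : Subset p
    a b e z : Fin p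

  sumOf? : ∀ A B z → Dec (∃ λ a → a ∈ A × z ⊖ a ∈ B)
  sumOf? A B z = any? λ a → a ∈? A ×-dec (z ⊖ a) ∈? B

  infixl 6 _⊞_
  _⊞_ : Subset p → Subset p → Subset p
  A ⊞ B = select (sumOf? A B)

  ⊞⁺ : a ∈ A → b ∈ B → a ⊕ b ≡ z → z ∈ A ⊞ B
  ⊞⁺ {a} {A} {b} {B} a∈A b∈B refl = ∈-select⁺ (sumOf? A B) (a , a∈A , subst (_∈ B) (sym a⊕b⊖a≡b) b∈B)
    where
    a⊕b⊖a≡b : a ⊕ b ⊖ a ≡ b
    a⊕b⊖a≡b = trans (cong (_⊖ a) (⊕-comm a b)) (⊕-⊖-cancel b a)

  ⊞⁻ : z ∈ A ⊞ B → ∃₂ λ a b → a ∈ A × b ∈ B × a ⊕ b ≡ z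
  ⊞⁻ {z} {A} {B} z∈A⊞B with a , a∈A , z⊖a∈B ← ∈-select⁻ (sumOf? A B) z∈A⊞B =
    a , z ⊖ a , a∈A , z⊖a∈B , ⊕-⊖-cancelˡ a z

  shift : Fin p → Subset p → Subset p
  shift e = preimage (_⊖ e)

  ∣shift∣ : ∀ e X → ∣ shift e X ∣ ≡ ∣ X ∣
  ∣shift∣ e = ∣preimage∣ (permutation (_⊖ e) (_⊕ e) (λ y → ⊕-⊖-cancel y e) (λ x → ⊖-⊕-cancel x e))

  ∈-shift⁺ : ∀ {X x} e → x ⊖ e ∈ X → x ∈ shift e X
  ∈-shift⁺ e = ∈-preimage⁺ (_⊖ e)

  ∈-shift⁻ : ∀ {X x} e → x ∈ shift e X → x ⊖ e ∈ X
  ∈-shift⁻ e = ∈-preimage⁻ (_⊖ e)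

  shift⊆⊞ : b ∈ B → shift b A ⊆ A ⊞ B
  shift⊆⊞ {b} b∈B {x} x∈ = ⊞⁺ (∈-shift⁻ b x∈) b∈B (⊖-⊕-cancel x b)

  ∉⊞⇒⊖∉ : b ∈ B → z ∉ A ⊞ B → z ⊖ b ∉ A
  ∉⊞⇒⊖∉ {b} {z = z} b∈B z∉A⊞B z⊖b∈A = z∉A⊞B (⊞⁺ z⊖b∈A b∈B (⊖-⊕-cancel z b))

  separating-shift : ∀ {w b₁ b₂} → a ∈ A → w ∉ A → b₁ ≢ b₂ → ∃ λ e → b₁ ⊕ e ∈ A × b₂ ⊕ e ∉ A
  separating-shift {A = A} {w} {b₁} {b₂} a∈A w∉A b₁≢b₂
    with any? (λ e → b₁ ⊕ e ∈? A ×-dec ¬? (b₂ ⊕ e ∈? A))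
  ... | yes separated = separated
  ... | no ¬separated = contradiction (⊕-closed⇒universal prime (_∈ A) d≢0 closed a∈A w) w∉A
    where
    d : Fin p
    d = b₂ ⊖ b₁
    d≢0 : d ≢ 0ₚ
    d≢0 = b₁≢b₂ ∘ sym ∘ ⊖≡0ₚ⇒≡
    closed : ∀ {x} → x ∈ A → x ⊕ d ∈ A
    closed {x} x∈A = subst (_∈ A) (⊕-⊖-swap b₂ x b₁)
      (decidable-stable (b₂ ⊕ (x ⊖ b₁) ∈? A) λ b₂+e∉A →
        ¬separated (x ⊖ b₁ , subst (_∈ A) (sym (⊕-⊖-cancelˡ b₁ x)) x∈A , b₂+e∉A))

  -- Davenport's e-transform keeps |A| + |B| and does not enlarge the sumset; for e with
  -- b₁ + e ∈ A and b₂ + e ∉ A it removes b₂ from B but keeps b₁.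
  module DavenportTransform (A B : Subset p) (e : Fin p) where

    A′ B′ : Subset p
    A′ = A ∪ shift e B
    B′ = B ∩ preimage (_⊕ e) A

    A′⊞B′⊆A⊞B : A′ ⊞ B′ ⊆ A ⊞ B
    A′⊞B′⊆A⊞B x∈ with a′ , b′ , a′∈A′ , b′∈B′ , a′⊕b′≡x ← ⊞⁻ x∈ | x∈p∩q⁻ B _ b′∈B′
    ... | b′∈B , b′⊕e∈A with x∈p∪q⁻ A _ a′∈A′
    ...   | inj₁ a′∈A = ⊞⁺ a′∈A b′∈B a′⊕b′≡x
    ...   | inj₂ a′∈B+e = ⊞⁺ (∈-preimage⁻ (_⊕ e) b′⊕e∈A) (∈-shift⁻ e a′∈B+e)
                             (trans (⊕-⊖-interchange a′ b′ e) a′⊕b′≡x)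

    A∩shift≡shiftB′ : A ∩ shift e B ≡ shift e B′
    A∩shift≡shiftB′ = ⊆-antisym
      (λ {x} x∈ → let x∈A , x⊖e∈B = x∈p∩q⁻ A _ x∈ in
        ∈-shift⁺ e (x∈p∩q⁺ {p = B} (∈-shift⁻ e x⊖e∈B ,
                            ∈-preimage⁺ (_⊕ e) (subst (_∈ A) (sym (⊖-⊕-cancel x e)) x∈A))))
      (λ {x} x∈ → let x⊖e∈B , x⊖e⊕e∈A = x∈p∩q⁻ B _ (∈-shift⁻ e x∈) in
        x∈p∩q⁺ (subst (_∈ A) (⊖-⊕-cancel x e) (∈-preimage⁻ (_⊕ e) x⊖e⊕e∈A) , ∈-shift⁺ e x⊖e∈B))

    ∣A′∣+∣B′∣≡∣A∣+∣B∣ : ∣ A′ ∣ + ∣ B′ ∣ ≡ ∣ A ∣ + ∣ B ∣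
    ∣A′∣+∣B′∣≡∣A∣+∣B∣ = begin
      ∣ A′ ∣ + ∣ B′ ∣                       ≡⟨ cong (∣ A′ ∣ +_) (∣shift∣ e B′) ⟨
      ∣ A′ ∣ + ∣ shift e B′ ∣               ≡⟨ cong (λ X → ∣ A′ ∣ + ∣ X ∣) A∩shift≡shiftB′ ⟨
      ∣ A ∪ shift e B ∣ + ∣ A ∩ shift e B ∣  ≡⟨ ∣p∪q∣+∣p∩q∣≡∣p∣+∣q∣ A (shift e B) ⟩
      ∣ A ∣ + ∣ shift e B ∣                 ≡⟨ cong (∣ A ∣ +_) (∣shift∣ e B) ⟩
      ∣ A ∣ + ∣ B ∣                         ∎
      where open ≡-Reasoning

  cauchy-davenport-⊆⁅⁆ : b ∈ B → B ⊆ ⁅ b ⁆ → ∣ A ∣ + ∣ B ∣ ≤ suc ∣ A ⊞ B ∣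
  cauchy-davenport-⊆⁅⁆ {b} {B} {A} b∈B B⊆⁅b⁆ = begin
    ∣ A ∣ + ∣ B ∣          ≤⟨ +-monoʳ-≤ ∣ A ∣ (≤-trans (p⊆q⇒∣p∣≤∣q∣ B⊆⁅b⁆) (≤-reflexive (∣⁅x⁆∣≡1 b))) ⟩
    ∣ A ∣ + 1              ≡⟨ +-comm ∣ A ∣ 1 ⟩
    suc ∣ A ∣              ≡⟨ cong suc (∣shift∣ b A) ⟨
    suc ∣ shift b A ∣      ≤⟨ s≤s (p⊆q⇒∣p∣≤∣q∣ (shift⊆⊞ b∈B)) ⟩
    suc ∣ A ⊞ B ∣          ∎
    where open ≤-Reasoning

  cauchy-davenport : a ∈ A → b ∈ B → z ∉ A ⊞ B → ∣ A ∣ + ∣ B ∣ ≤ suc ∣ A ⊞ B ∣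
  cauchy-davenport {B = B} = go (⊂-wellFounded B)
    where
    go : ∀ {A B a b₁ z} → Acc _⊂_ B → a ∈ A → b₁ ∈ B → z ∉ A ⊞ B → ∣ A ∣ + ∣ B ∣ ≤ suc ∣ A ⊞ B ∣
    go {A} {B} {b₁ = b₁} (acc smaller) a∈A b₁∈B z∉A⊞B
      with any? (λ b → b ∈? B ×-dec ¬? (b ≟ b₁))
    ... | no ¬other = cauchy-davenport-⊆⁅⁆ b₁∈B λ {b} b∈B → subst (_∈ ⁅ b₁ ⁆)
      (sym (decidable-stable (b ≟ b₁) λ b≢b₁ → ¬other (b , b∈B , b≢b₁))) (x∈⁅x⁆ b₁)
    ... | yes (b₂ , b₂∈B , b₂≢b₁)
      with e , b₁⊕e∈A , b₂⊕e∉A ← separating-shift a∈A (∉⊞⇒⊖∉ b₁∈B z∉A⊞B) (b₂≢b₁ ∘ sym) = begin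
      ∣ A ∣ + ∣ B ∣          ≡⟨ ∣A′∣+∣B′∣≡∣A∣+∣B∣ ⟨
      ∣ A′ ∣ + ∣ B′ ∣        ≤⟨ go (smaller B′⊂B) (p⊆p∪q _ a∈A) b₁∈B′ (z∉A⊞B ∘ A′⊞B′⊆A⊞B) ⟩
      suc ∣ A′ ⊞ B′ ∣        ≤⟨ s≤s (p⊆q⇒∣p∣≤∣q∣ A′⊞B′⊆A⊞B) ⟩
      suc ∣ A ⊞ B ∣          ∎
      where
      open DavenportTransform A B e
      b₁∈B′ : b₁ ∈ B′
      b₁∈B′ = x∈p∩q⁺ (b₁∈B , ∈-preimage⁺ (_⊕ e) b₁⊕e∈A)
      B′⊂B : B′ ⊂ B
      B′⊂B = p∩q⊆p B _ , b₂ , b₂∈B , b₂⊕e∉A ∘ ∈-preimage⁻ (_⊕ e) ∘ proj₂ ∘ x∈p∩q⁻ B _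
      open ≤-Reasoning

-- Walks and rooted subtrees

module _ {n : ℕ} (G : Graph n) where

  private variable
    A B : Subset n
    r c x y z : Fin n

  WalkIn-mono : A ⊆ B → WalkIn G A x y → WalkIn G B x y
  WalkIn-mono A⊆B (here x∈A)         = here (A⊆B x∈A)
  WalkIn-mono A⊆B (step x∈A xy walk) = step (A⊆B x∈A) xy (WalkIn-mono A⊆B walk)

  _++ʷ_ : WalkIn G A x y → WalkIn G A y z → WalkIn G A x z
  here _          ++ʷ walk′ = walk′
  step x∈A xy walk ++ʷ walk′ = step x∈A xy (walk ++ʷ walk′)

  crossing-edge : WalkIn G A x y → x ∈ B → y ∉ B → ∃₂ λ u v → u ∈ B × v ∉ B × E G u v
  crossing-edge (here _) x∈B x∉B = contradiction x∈B x∉B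
  crossing-edge {B = B} (step {x} {y′} _ xy′ walk) x∈B y∉B with y′ ∈? B
  ... | yes y′∈B = crossing-edge walk y′∈B y∉B
  ... | no  y′∉B = x , y′ , x∈B , y′∉B , xy′

  connected-⁅⁆ : ConnectedSet G ⁅ r ⁆
  connected-⁅⁆ {r} x y x∈ y∈ rewrite x∈⁅y⁆⇒x≡y r x∈ | x∈⁅y⁆⇒x≡y r y∈ = here (x∈⁅x⁆ r)

  connected-∪ : E G r c → r ∈ A → c ∈ B → ConnectedSet G A → ConnectedSet G B → ConnectedSet G (A ∪ B)
  connected-∪ {r} {c} {A} {B} rc r∈A c∈B A-connected B-connected x y x∈ y∈ = to-r x∈ ++ʷ from-r y∈
    where
    inˡ : A ⊆ A ∪ B
    inˡ = p⊆p∪q B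
    inʳ : B ⊆ A ∪ B
    inʳ = q⊆p∪q A B
    to-r : ∀ {u} → u ∈ A ∪ B → WalkIn G (A ∪ B) u r
    to-r {u} u∈ with x∈p∪q⁻ A B u∈
    ... | inj₁ u∈A = WalkIn-mono inˡ (A-connected u r u∈A r∈A)
    ... | inj₂ u∈B = WalkIn-mono inʳ (B-connected u c u∈B c∈B) ++ʷ
                     step (inʳ c∈B) (Graph.sym G rc) (here (inˡ r∈A))
    from-r : ∀ {u} → u ∈ A ∪ B → WalkIn G (A ∪ B) r u
    from-r {u} u∈ with x∈p∪q⁻ A B u∈
    ... | inj₁ u∈A = WalkIn-mono inˡ (A-connected r u r∈A u∈A)
    ... | inj₂ u∈B = step (inˡ r∈A) rc (WalkIn-mono inʳ (B-connected c u c∈B u∈B))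

  data Subtree : Fin n → Subset n → Set where
    leaf  : ∀ r → Subtree r ⁅ r ⁆
    graft : Subtree r A → E G r c → Subtree c B → Disjoint A B → Subtree r (A ∪ B)

  root∈ : Subtree r A → r ∈ A
  root∈ (leaf r)          = x∈⁅x⁆ r
  root∈ (graft τ _ _ _)   = p⊆p∪q _ (root∈ τ)

  add-leaf : Subtree r A → x ∈ A → y ∉ A → E G x y → Subtree r (A ∪ ⁅ y ⁆)
  add-leaf (leaf r) x∈ y∉ xy =
    graft (leaf r) (subst (λ u → E G u _) (x∈⁅y⁆⇒x≡y r x∈) xy) (leaf _) (∉⇒Disjoint⁅⁆ y∉)
  add-leaf {r} {y = y} (graft {A = A₁} {B = A₂} τ₁ rc τ₂ A₁#A₂) x∈ y∉ xy with x∈p∪q⁻ A₁ A₂ x∈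
  ... | inj₁ x∈A₁ = subst (Subtree r) reassoc
    (graft (add-leaf τ₁ x∈A₁ (y∉ ∘ p⊆p∪q A₂) xy) rc τ₂
           (Disjoint-∪ˡ A₁#A₂ (Disjoint-sym (∉⇒Disjoint⁅⁆ (y∉ ∘ q⊆p∪q A₁ A₂)))))
    where
    reassoc : (A₁ ∪ ⁅ y ⁆) ∪ A₂ ≡ (A₁ ∪ A₂) ∪ ⁅ y ⁆
    reassoc = trans (∪-assoc A₁ ⁅ y ⁆ A₂) (trans (cong (A₁ ∪_) (∪-comm ⁅ y ⁆ A₂)) (sym (∪-assoc A₁ A₂ ⁅ y ⁆)))
  ... | inj₂ x∈A₂ = subst (Subtree r) (sym (∪-assoc A₁ A₂ ⁅ y ⁆))
    (graft τ₁ rc (add-leaf τ₂ x∈A₂ (y∉ ∘ q⊆p∪q A₁ A₂) xy)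
           (Disjoint-∪ʳ A₁#A₂ (∉⇒Disjoint⁅⁆ (y∉ ∘ p⊆p∪q A₂))))

  spanning-tree : ConnectedSet G ⊤ → ∀ r → Subtree r ⊤
  spanning-tree connected r = grow (leaf r) (⊃-wellFounded ⁅ r ⁆)
    where
    grow : Subtree r A → Acc _⊃_ A → Subtree r ⊤
    grow {A} τ (acc larger) with nonempty? (∁ A)
    ... | no ∁A-empty = subst (Subtree r) (Empty∁⇒≡⊤ ∁A-empty) τ
    ... | yes (v , v∈∁A)
      with x , y , x∈A , y∉A , xy ← crossing-edge (connected r v ∈⊤ ∈⊤) (root∈ τ) (x∈∁p⇒x∉p v∈∁A)
      = grow (add-leaf τ x∈A y∉A xy) (larger (p⊆p∪q ⁅ y ⁆ , y , q⊆p∪q A ⁅ y ⁆ (x∈⁅x⁆ y) , y∉A))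

-- Values of connected sets through the root

module ZeroAvoidingQ {n p} (prime : Prime p) (G : Graph n) (ℓ : Fin n → Fin p)
                     (zero-avoiding : ZeroAvoiding p {{prime⇒nonZero prime}} G ℓ) where

  private instance
    p≢0 : NonZero p
    p≢0 = prime⇒nonZero prime

  open ZMod p
  open CauchyDavenport prime

  private variable
    W W₁ W₂ : Subset n
    r c : Fin n
    z : Fin p

  ℓ[_] : Subset n → Fin p
  ℓ[ A ] = sumOver A (toℕ ∘ ℓ) mod p

  toℕ-ℓ[] : ∀ A → toℕ ℓ[ A ] ≡ weight p ℓ A
  toℕ-ℓ[] A = trans (toℕ-mod _)
    (cong (_% p) (sym (sumFin≡sum λ x → if lookup A x then toℕ (ℓ x) else 0)))

  ℓ[∪] : ∀ {A B} → Disjoint A B → ℓ[ A ∪ B ] ≡ ℓ[ A ] ⊕ ℓ[ B ]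
  ℓ[∪] A#B = trans (cong (_mod p) (sumOver-∪ (toℕ ∘ ℓ) A#B)) (mod-distrib-+ _ _)

  ℓ[⁅⁆] : ∀ r → ℓ[ ⁅ r ⁆ ] ≡ ℓ r
  ℓ[⁅⁆] r = trans (cong (_mod p) (sumOver-⁅⁆ r (toℕ ∘ ℓ))) (mod-toℕ (ℓ r))

  record Realisation (r : Fin n) (W : Subset n) (z : Fin p) : Set where
    field
      A          : Subset n
      A⊆W        : A ⊆ W
      r∈A        : r ∈ A
      connected  : ConnectedSet G A
      ℓ[A]≡z     : ℓ[ A ] ≡ z

  open Realisation

  realised⇒≢0ₚ : Realisation r W z → z ≢ 0ₚ
  realised⇒≢0ₚ ρ z≡0 = zero-avoiding (A ρ) (_ , r∈A ρ) (connected ρ)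
    (trans (sym (toℕ-ℓ[] (A ρ))) (trans (cong toℕ (trans (ℓ[A]≡z ρ) z≡0)) toℕ-0ₚ))

  realised⇒InQ : Realisation r W z → InQ p G ℓ r z
  realised⇒InQ ρ = A ρ , r∈A ρ , connected ρ , trans (sym (toℕ-ℓ[] (A ρ))) (cong toℕ (ℓ[A]≡z ρ))

  weaken : W₁ ⊆ W₂ → Realisation r W₁ z → Realisation r W₂ z
  weaken W₁⊆W₂ ρ = record
    { A = A ρ ; A⊆W = W₁⊆W₂ ∘ A⊆W ρ ; r∈A = r∈A ρ ; connected = connected ρ ; ℓ[A]≡z = ℓ[A]≡z ρ }

  join : ∀ {a b} → E G r c → Disjoint W₁ W₂ →
         Realisation r W₁ a → Realisation c W₂ b → Realisation r (W₁ ∪ W₂) (a ⊕ b)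
  join {W₁ = W₁} {W₂} rc W₁#W₂ ρ σ = record
    { A         = A ρ ∪ A σ
    ; A⊆W       = λ x∈ → [ p⊆p∪q W₂ ∘ A⊆W ρ , q⊆p∪q W₁ W₂ ∘ A⊆W σ ]′ (x∈p∪q⁻ (A ρ) (A σ) x∈)
    ; r∈A       = p⊆p∪q (A σ) (r∈A ρ)
    ; connected = connected-∪ G rc (r∈A ρ) (r∈A σ) (connected ρ) (connected σ)
    ; ℓ[A]≡z    = trans (ℓ[∪] λ x∈ρ x∈σ → W₁#W₂ (A⊆W ρ x∈ρ) (A⊆W σ x∈σ)) (cong₂ _⊕_ (ℓ[A]≡z ρ) (ℓ[A]≡z σ))
    }

  record LargeQ (r : Fin n) (W : Subset n) : Set where
    field
      Q        : Subset p
      realise  : ∀ {z} → z ∈ Q → Realisation r W z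
      ℓr∈Q     : ℓ r ∈ Q  -- keeps Q nonempty, as Cauchy–Davenport requires
      ∣W∣≤∣Q∣   : ∣ W ∣ ≤ ∣ Q ∣

  open LargeQ

  leaf-Q : ∀ r → LargeQ r ⁅ r ⁆
  leaf-Q r = record
    { Q       = ⁅ ℓ r ⁆
    ; realise = λ z∈ → record
      { A = ⁅ r ⁆ ; A⊆W = id ; r∈A = x∈⁅x⁆ r ; connected = connected-⁅⁆ G
      ; ℓ[A]≡z = trans (ℓ[⁅⁆] r) (sym (x∈⁅y⁆⇒x≡y _ z∈)) }
    ; ℓr∈Q    = x∈⁅x⁆ (ℓ r)
    ; ∣W∣≤∣Q∣  = ≤-reflexive (trans (∣⁅x⁆∣≡1 r) (sym (∣⁅x⁆∣≡1 (ℓ r))))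
    }

  realise-⊞ : E G r c → Disjoint W₁ W₂ → (L₁ : LargeQ r W₁) (L₂ : LargeQ c W₂) →
              z ∈ Q L₁ ⊞ (Q L₂ ∪ ⁅ 0ₚ ⁆) → Realisation r (W₁ ∪ W₂) z
  realise-⊞ {r} {W₂ = W₂} {z} rc W₁#W₂ L₁ L₂ z∈
    with a , b , a∈Q₁ , b∈Q₂⁰ , a⊕b≡z ← ⊞⁻ z∈ | x∈p∪q⁻ (Q L₂) _ b∈Q₂⁰
  ... | inj₁ b∈Q₂ = subst (Realisation r _) a⊕b≡z (join rc W₁#W₂ (realise L₁ a∈Q₁) (realise L₂ b∈Q₂))
  ... | inj₂ b∈⁅0⁆ = subst (Realisation r _) a≡z (weaken (p⊆p∪q W₂) (realise L₁ a∈Q₁))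
    where
    a≡z : a ≡ z
    a≡z = trans (sym (⊕-identityʳ a)) (trans (cong (a ⊕_) (sym (x∈⁅y⁆⇒x≡y 0ₚ b∈⁅0⁆))) a⊕b≡z)

  graft-Q : E G r c → Disjoint W₁ W₂ → LargeQ r W₁ → LargeQ c W₂ → LargeQ r (W₁ ∪ W₂)
  graft-Q {r} {W₁ = W₁} {W₂} rc W₁#W₂ L₁ L₂ = record
    { Q       = Q′
    ; realise = realise-⊞ rc W₁#W₂ L₁ L₂
    ; ℓr∈Q    = ⊞⁺ (ℓr∈Q L₁) 0ₚ∈Q₂⁰ (⊕-identityʳ (ℓ r))
    ; ∣W∣≤∣Q∣  = begin
        ∣ W₁ ∪ W₂ ∣        ≡⟨ ∣p∪q∣≡∣p∣+∣q∣ W₁#W₂ ⟩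
        ∣ W₁ ∣ + ∣ W₂ ∣     ≤⟨ +-mono-≤ (∣W∣≤∣Q∣ L₁) (∣W∣≤∣Q∣ L₂) ⟩
        ∣ Q₁ ∣ + ∣ Q₂ ∣     ≤⟨ ≤-pred 1+∣Q₁∣+∣Q₂∣≤1+∣Q′∣ ⟩
        ∣ Q′ ∣             ∎
    }
    where
    open ≤-Reasoning
    Q₁ Q₂ Q₂⁰ Q′ : Subset p
    Q₁  = Q L₁
    Q₂  = Q L₂
    Q₂⁰ = Q₂ ∪ ⁅ 0ₚ ⁆
    Q′  = Q₁ ⊞ Q₂⁰
    0ₚ∈Q₂⁰ : 0ₚ ∈ Q₂⁰
    0ₚ∈Q₂⁰ = q⊆p∪q Q₂ _ (x∈⁅x⁆ 0ₚ)
    0ₚ∉Q₂ : 0ₚ ∉ Q₂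
    0ₚ∉Q₂ 0∈Q₂ = realised⇒≢0ₚ (realise L₂ 0∈Q₂) refl
    0ₚ∉Q′ : 0ₚ ∉ Q′
    0ₚ∉Q′ 0∈Q′ = realised⇒≢0ₚ (realise-⊞ rc W₁#W₂ L₁ L₂ 0∈Q′) refl
    ∣Q₂⁰∣≡1+∣Q₂∣ : ∣ Q₂⁰ ∣ ≡ suc (∣ Q₂ ∣)
    ∣Q₂⁰∣≡1+∣Q₂∣ = trans (∣p∪q∣≡∣p∣+∣q∣ (∉⇒Disjoint⁅⁆ 0ₚ∉Q₂))
                        (trans (cong (∣ Q₂ ∣ +_) (∣⁅x⁆∣≡1 0ₚ)) (+-comm (∣ Q₂ ∣) 1))
    1+∣Q₁∣+∣Q₂∣≤1+∣Q′∣ : suc (∣ Q₁ ∣ + ∣ Q₂ ∣) ≤ suc (∣ Q′ ∣)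
    1+∣Q₁∣+∣Q₂∣≤1+∣Q′∣ = begin
      suc (∣ Q₁ ∣ + ∣ Q₂ ∣)   ≡⟨ +-suc (∣ Q₁ ∣) (∣ Q₂ ∣) ⟨
      ∣ Q₁ ∣ + suc (∣ Q₂ ∣)   ≡⟨ cong (∣ Q₁ ∣ +_) ∣Q₂⁰∣≡1+∣Q₂∣ ⟨
      ∣ Q₁ ∣ + ∣ Q₂⁰ ∣        ≤⟨ cauchy-davenport (ℓr∈Q L₁) 0ₚ∈Q₂⁰ 0ₚ∉Q′ ⟩
      suc (∣ Q′ ∣)            ∎

  large-Q : Subtree G r W → LargeQ r W
  large-Q (leaf r)                = leaf-Q r
  large-Q (graft τ₁ rc τ₂ W₁#W₂) = graft-Q rc W₁#W₂ (large-Q τ₁) (large-Q τ₂)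

lemma3p2 : (p : ℕ) → (pr : Prime p) → (n : ℕ) → (T : Graph n) → IsTree T →
    (ℓ : Fin n → Fin p) → ZeroAvoiding p {{prime⇒nonZero pr}} T ℓ →
    (t : Fin n) →
    Σ (Fin n → Fin p) λ f → Injective _≡_ _≡_ f × (∀ i → InQ p {{prime⇒nonZero pr}} T ℓ t (f i))
lemma3p2 p pr n T (_ , connected , _) ℓ zero-avoiding t =
  let f , f-injective , f∈Q = injection-into Q (subst (_≤ ∣ Q ∣) (∣⊤∣≡n n) ∣W∣≤∣Q∣)
  in  f , f-injective , realised⇒InQ ∘ realise ∘ f∈Q
  where
  open ZeroAvoidingQ pr T ℓ zero-avoiding
  open LargeQ (large-Q (spanning-tree T connected t))
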